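{- Let $L$ be a finite semimodular lattice and let $Q\in\mathfrak{E}(L)$ with $|A(Q)|>|J(L)|$. Then there exists an element $r\in Q\setminus L$ such that $P:=Q\setminus\{r\}$ (with the induced order) belongs to $\mathfrak{E}(L)$. Moreover, the family $\mathcal{T}^P_L=\{A_Q(x)\setminus\{r\}: x\in L\}$, ordered by inclusion, is isomorphic to $L$ and is a cover-preserving sublattice of $(\mathcal{S}_P,\subseteq)$, where $\mathcal{S}_P=\{A_P(y): y\in P\}$.
   Context: $A(K)$ denotes the set of atoms of a lattice $K$, $A_K(y)$ the set of atoms of $K$ below $y$, and $J(L)$ the set of non-zero join-irreducible elements of $L$. Let $H(L)=L\setminus(A(L)\cup\{0\})$. For each $x\in H(L)$ let $\Delta(x)$ be a finite (possibly empty) set with $\Delta(x)\cap L=\emptyset$ and $\Delta(x)\cap\Delta(y)=\emptyset$ for $x\neq y$. Put $P=L\cup\bigcup_{x\in H(L)}\Delta(x)$, ordered by extending the order of $L$ so that $0\prec x'\prec x$ for every $x'\in\Delta(x)$ (i.e. for $x'\in\Delta(x)$: $0\leq x'$, and $x'\leq z$ for $z\in L$ iff $x\leq z$ in $L$, and $x'$ is incomparable with all other inserted elements). Such a $P$ is called an extending standard form of $L$ if $\Delta(x)\neq\emptyset$ for every $x\in J(L)\cap H(L)$; $\mathfrak{E}(L)$ denotes the set of all finite extending standard forms of $L$. A sublattice is cover-preserving if coverings in it remain coverings in the larger lattice. -}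

module Defs where

open import Data.Nat using (ℕ; _<_)
open import Data.Fin using (Fin)
open import Data.Sum using (_⊎_; inj₁; inj₂)
open import Data.Product using (Σ; _×_; _,_)
open import Data.Unit using (⊤)
open import Data.List using (List; length)
open import Data.List.Relation.Unary.All using (All)
open import Data.List.Relation.Unary.Unique.Propositional using (Unique)
open import Data.List.Membership.Propositional using (_∈_)
open import Relation.Nullary using (¬_)
open import Relation.Binary using (Rel; Decidable)
open import Relation.Binary.PropositionalEquality using (_≡_; _≢_)
open import Relation.Binary.Lattice.Structures using (IsLattice)
open import Level using (0ℓ)

-- Generic order-theoretic notions for a relation R on a type X,
-- restricted to the elements satisfying a domain predicate D
-- (D describes the underlying set of the poset; the order is R restricted).

Whole : {X : Set} → X → Set
Whole _ = ⊤

module _ {X : Set} (D : X → Set) (R : X → X → Set) where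

  Lt : X → X → Set
  Lt a b = R a b × ¬ R b a

  IsBot : X → Set
  IsBot a = D a × (∀ b → D b → R a b)

  Covers : X → X → Set
  Covers a b = D a × D b × Lt a b × (∀ c → D c → Lt a c → ¬ Lt c b)

  IsAtom : X → Set
  IsAtom a = Σ X λ z → IsBot z × Covers z a

record FinLattice : Set₁ where
  field
    n         : ℕ
    _≤_       : Rel (Fin n) 0ℓ
    _∨_       : Fin n → Fin n → Fin n
    _∧_       : Fin n → Fin n → Fin n
    isLattice : IsLattice _≡_ _≤_ _∨_ _∧_
    _≤?_      : Decidable _≤_

module _ (L : FinLattice) where
  open FinLattice L

  Semimodular : Set
  Semimodular = ∀ a b → Covers Whole _≤_ (a ∧ b) a → Covers Whole _≤_ b (a ∨ b)

  JoinIrr : Fin n → Set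
  JoinIrr a = ¬ IsBot Whole _≤_ a × (∀ b c → (b ∨ c) ≡ a → b ≡ a ⊎ c ≡ a)

  InH : Fin n → Set
  InH a = ¬ IsBot Whole _≤_ a × ¬ IsAtom Whole _≤_ a

  -- Data of a standard form: Δ(x) is represented by its size d x
  -- (the sets Δ(x) are disjoint from L and from each other; only their
  -- cardinalities matter).  Δ(x) exists only for x ∈ H(L).
  ValidΔ : (Fin n → ℕ) → Set
  ValidΔ d = ∀ x → 0 < d x → InH x

  IsESF : (Fin n → ℕ) → Set
  IsESF d = ValidΔ d × (∀ x → JoinIrr x → InH x → 0 < d x)

  Elt : (Fin n → ℕ) → Set
  Elt d = Fin n ⊎ Σ (Fin n) (λ x → Fin (d x))

  Ord : (d : Fin n → ℕ) → Elt d → Elt d → Set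
  Ord d (inj₁ a) (inj₁ b) = a ≤ b
  Ord d (inj₁ a) (inj₂ _) = IsBot Whole _≤_ a
  Ord d (inj₂ (x , _)) (inj₁ b) = x ≤ b
  Ord d (inj₂ p) (inj₂ q) = p ≡ q

HasSize : {X : Set} → (X → Set) → ℕ → Set
HasSize {X} S k = Σ (List X) λ xs →
  Unique xs × All S xs × (∀ x → S x → x ∈ xs) × length xs ≡ k

_⊆_ : {X : Set} → (X → Set) → (X → Set) → Set
A ⊆ B = ∀ x → A x → B x

_≐_ : {X : Set} → (X → Set) → (X → Set) → Set
A ≐ B = A ⊆ B × B ⊆ A

_⊂_ : {X : Set} → (X → Set) → (X → Set) → Set
A ⊂ B = A ⊆ B × ¬ (B ⊆ A)

module _ (L : FinLattice) (d : Fin (FinLattice.n L) → ℕ) (r : Elt L d) where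
  open FinLattice L

  -- underlying set of P = Q ∖ {r}; its order is the induced one
  DP : Elt L d → Set
  DP q = q ≢ r

  -- P ∈ 𝔈(L): P, with the order induced from Q, is an extending
  -- standard form of L, i.e. there is an ESF datum d' and an order
  -- isomorphism ψ from the ESF built from d' onto Q ∖ {r} fixing L.
  RemovalIsESF : Set
  RemovalIsESF = Σ (Fin n → ℕ) λ d' → IsESF L d' ×
    Σ (Elt L d' → Elt L d) λ ψ →
      (∀ p → DP (ψ p)) ×
      (∀ q → DP q → Σ (Elt L d') λ p → ψ p ≡ q) ×
      (∀ p p' → ψ p ≡ ψ p' → p ≡ p') ×
      (∀ p p' → (Ord L d' p p' → Ord L d (ψ p) (ψ p')) × (Ord L d (ψ p) (ψ p') → Ord L d' p p')) ×
      (∀ a → ψ (inj₁ a) ≡ inj₁ a)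

  Tset : Fin n → Elt L d → Set
  Tset x a = IsAtom Whole (Ord L d) a × Ord L d a (inj₁ x) × a ≢ r

  AP : Elt L d → Elt L d → Set
  AP y a = IsAtom DP (Ord L d) a × Ord L d a y

  TIsoL : Set
  TIsoL = Σ (Fin n → Fin n) λ h →
    (∀ z → Σ (Fin n) λ x → Tset (h x) ≐ Tset z) ×
    (∀ x y → (x ≤ y → Tset (h x) ⊆ Tset (h y)) × (Tset (h x) ⊆ Tset (h y) → x ≤ y))

  TSublattice : Set
  TSublattice =
    (∀ x → Σ (Elt L d) λ y → DP y × Tset x ≐ AP y) ×
    (∀ x y → Σ (Fin n) λ z → Tset x ⊆ Tset z × Tset y ⊆ Tset z ×
        (∀ w → DP w → Tset x ⊆ AP w → Tset y ⊆ AP w → Tset z ⊆ AP w)) ×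
    (∀ x y → Σ (Fin n) λ z → Tset z ⊆ Tset x × Tset z ⊆ Tset y ×
        (∀ w → DP w → AP w ⊆ Tset x → AP w ⊆ Tset y → AP w ⊆ Tset z))

  TCoverPreserving : Set
  TCoverPreserving = ∀ x y → Tset x ⊂ Tset y →
    (∀ z → ¬ (Tset x ⊂ Tset z × Tset z ⊂ Tset y)) →
    ∀ w → DP w → ¬ (Tset x ⊂ AP w × AP w ⊂ Tset y)

module Submission where

-- The atoms of Q are the atoms of L and all inserted points. If every Δ(x) had at
-- most one point, and only over join-irreducible x, then mapping an atom to itself
-- and an inserted point to its anchor x would inject A(Q) into J(L). So some Δ(x₀)
-- has a point r whose removal keeps Δ(x₀) nonempty when x₀ ∈ J(L), and Q ∖ {r} is
-- again an extending standard form. For x ∈ L the trace A_Q(x) ∖ {r} is A_P(x), and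
-- x ↦ A_P(x) reflects the order because each join-irreducible j is detected by an
-- atom of P lying below exactly the elements above j: j itself, or a remaining
-- point of Δ(j).

open import Data.Empty using (⊥-elim)
open import Data.Fin as Fin using (Fin; zero; suc)
import Data.Fin.Properties as Finₚ
open import Data.Fin.Induction using (po-wellFounded)
open import Data.List using (List; []; _∷_; _++_; length; map; foldr; allFin)
open import Data.List.Properties using (length-++-sucʳ; length-map)
open import Data.List.Membership.Propositional using (_∈_)
open import Data.List.Membership.Propositional.Properties
  using (∈-++⁻; ∈-++⁺ˡ; ∈-++⁺ʳ; ∈-∃++; ∈-map⁻; ∈-allFin)
open import Data.List.Relation.Unary.All as All using (All; []; _∷_)
import Data.List.Relation.Unary.All.Properties as Allₚ
open import Data.List.Relation.Unary.Any using (here; there)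
open import Data.List.Relation.Unary.AllPairs using ([]; _∷_)
open import Data.List.Relation.Unary.Unique.Propositional using (Unique)
open import Data.Nat as ℕ using (ℕ; zero; suc; pred; _<_; z≤n; s≤s)
import Data.Nat.Properties as ℕₚ
open import Data.Product using (Σ; ∃; ∃₂; _×_; _,_; proj₁; proj₂)
open import Data.Sum using (_⊎_; inj₁; inj₂)
open import Data.Sum.Properties using (inj₂-injective)
open import Data.Product.Properties using (,-injectiveˡ)
open import Data.Product.Properties.WithK using (,-injectiveʳ)
open import Data.Unit using (tt)
open import Function using (_∘_; id)
open import Induction.WellFounded using (WellFounded; Acc; acc; module Subrelation)
open import Relation.Binary.Lattice.Structures using (IsLattice)
open import Relation.Binary.PropositionalEquality
  using (_≡_; _≢_; refl; sym; cong; subst)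
open import Relation.Nullary using (¬_; Dec; yes; no)
open import Relation.Nullary.Decidable using (_×-dec_; _⊎-dec_; _→-dec_; ¬?; map′)

open import Defs

module _ {A : Set} where

  ∈-++-∷⁻ : ∀ {x y : A} us {vs} → y ∈ us ++ x ∷ vs → y ≢ x → y ∈ us ++ vs
  ∈-++-∷⁻ us y∈ y≢x with ∈-++⁻ us y∈
  ... | inj₁ y∈us         = ∈-++⁺ˡ y∈us
  ... | inj₂ (here y≡x)   = ⊥-elim (y≢x y≡x)
  ... | inj₂ (there y∈vs) = ∈-++⁺ʳ us y∈vs

  Unique-⊆⇒length≤ : ∀ {xs ys : List A} → Unique xs → (∀ {y} → y ∈ xs → y ∈ ys) →
                     length xs ℕ.≤ length ys
  Unique-⊆⇒length≤ {[]}     _           _  = z≤n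
  Unique-⊆⇒length≤ {x ∷ xs} (x∉xs ∷ xs!) xs⊆ys with ∈-∃++ (xs⊆ys (here refl))
  ... | us , vs , refl = subst (length (x ∷ xs) ℕ.≤_) (sym (length-++-sucʳ us x vs))
    (s≤s (Unique-⊆⇒length≤ xs! λ y∈xs →
      ∈-++-∷⁻ us (xs⊆ys (there y∈xs)) λ y≡x → All.lookup x∉xs y∈xs (sym y≡x)))

module _ {A B : Set} {S : A → Set} (f : A → B)
         (f-injective : ∀ {x y} → S x → S y → f x ≡ f y → x ≡ y) where

  Unique-map⁺-on : ∀ {xs} → All S xs → Unique xs → Unique (map f xs)
  Unique-map⁺-on []         []          = []
  Unique-map⁺-on (sx ∷ sxs) (x∉xs ∷ xs!) =
    Allₚ.map⁺ (All.zipWith (λ (sy , x≢y) → x≢y ∘ f-injective sx sy) (sxs , x∉xs))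
    ∷ Unique-map⁺-on sxs xs!

module _ {A B : Set} {S : A → Set} {T : B → Set} where

  HasSize-injection⇒≤ : ∀ {k m} → HasSize S k → HasSize T m →
    (f : A → B) → (∀ {x} → S x → T (f x)) →
    (∀ {x y} → S x → S y → f x ≡ f y → x ≡ y) → k ℕ.≤ m
  HasSize-injection⇒≤ (xs , xs! , Sxs , _ , refl) (ys , _ , _ , T⊆ys , refl) f f-T f-injective =
    subst (ℕ._≤ length ys) (length-map f xs)
      (Unique-⊆⇒length≤ (Unique-map⁺-on f f-injective Sxs xs!) fx∈ys)
    where
    fx∈ys : ∀ {y} → y ∈ map f xs → y ∈ ys
    fx∈ys y∈ with ∈-map⁻ f y∈
    ... | x , x∈xs , refl = T⊆ys (f x) (f-T (All.lookup Sxs x∈xs))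

HasSize-inhabited : ∀ {A : Set} {S : A → Set} {k} → HasSize S k → 0 < k → Σ A S
HasSize-inhabited (x ∷ _ , _ , Sx ∷ _ , _ , refl) _ = x , Sx

≐-sym : {X : Set} {A B : X → Set} → A ≐ B → B ≐ A
≐-sym (A⊆B , B⊆A) = B⊆A , A⊆B

module _ {X : Set} {A B C : X → Set} where

  ⊂-respʳ-≐ : B ≐ C → A ⊂ B → A ⊂ C
  ⊂-respʳ-≐ (B⊆C , C⊆B) (A⊆B , B⊈A) = (λ x → B⊆C x ∘ A⊆B x) , λ C⊆A → B⊈A λ x → C⊆A x ∘ B⊆C x

  ⊂-respˡ-≐ : A ≐ B → A ⊂ C → B ⊂ C
  ⊂-respˡ-≐ (A⊆B , B⊆A) (A⊆C , C⊈A) = (λ x → A⊆C x ∘ B⊆A x) , λ C⊆B → C⊈A λ x → B⊆A x ∘ C⊆B x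

module FiniteLattice (L : FinLattice) where
  open FinLattice L
  open IsLattice isLattice renaming (refl to ≤-refl; trans to ≤-trans; reflexive to ≤-reflexive)

  _<ᴸ_ : Fin n → Fin n → Set
  _<ᴸ_ = Lt Whole _≤_

  <ᴸ? : ∀ a b → Dec (a <ᴸ b)
  <ᴸ? a b = (a ≤? b) ×-dec ¬? (b ≤? a)

  ≤∧≢⇒<ᴸ : ∀ {a b} → a ≤ b → a ≢ b → a <ᴸ b
  ≤∧≢⇒<ᴸ a≤b a≢b = a≤b , λ b≤a → a≢b (antisym a≤b b≤a)

  <ᴸ-wellFounded : WellFounded _<ᴸ_
  <ᴸ-wellFounded = Subrelation.wellFounded
    (λ (a≤b , b≰a) → a≤b , λ a≡b → b≰a (≤-reflexive (sym a≡b)))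
    (po-wellFounded isPartialOrder)

  IsBot? : ∀ a → Dec (IsBot Whole _≤_ a)
  IsBot? a = map′ (λ a≤ → tt , λ b _ → a≤ b) (λ (_ , a≤) b → a≤ b tt) (Finₚ.all? (a ≤?_))

  JoinIrr? : ∀ a → Dec (JoinIrr L a)
  JoinIrr? a = ¬? (IsBot? a) ×-dec
    Finₚ.all? λ b → Finₚ.all? λ c →
      ((b ∨ c) Finₚ.≟ a) →-dec ((b Finₚ.≟ a) ⊎-dec (c Finₚ.≟ a))

  ¬JoinIrr⇒proper-join : ∀ a → ¬ IsBot Whole _≤_ a → ¬ JoinIrr L a →
                          ∃₂ λ b c → b ∨ c ≡ a × b ≢ a × c ≢ a
  ¬JoinIrr⇒proper-join a a≢⊥ ¬ji with Finₚ.any? (λ b → Finₚ.any? (λ c →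
    ((b ∨ c) Finₚ.≟ a) ×-dec ¬? (b Finₚ.≟ a) ×-dec ¬? (c Finₚ.≟ a)))
  ... | yes (b , c , join) = b , c , join
  ... | no ¬join = ⊥-elim (¬ji (a≢⊥ , irreducible))
    where
    irreducible : ∀ b c → b ∨ c ≡ a → b ≡ a ⊎ c ≡ a
    irreducible b c b∨c≡a with b Finₚ.≟ a | c Finₚ.≟ a
    ... | yes b≡a | _       = inj₁ b≡a
    ... | no _    | yes c≡a = inj₂ c≡a
    ... | no b≢a  | no c≢a  = ⊥-elim (¬join (b , c , b∨c≡a , b≢a , c≢a))

  -- Every element is the join of the join-irreducibles below it.
  ≤-by-joinIrr : ∀ x y → (∀ j → JoinIrr L j → j ≤ x → j ≤ y) → x ≤ y
  ≤-by-joinIrr x y = go x (<ᴸ-wellFounded x)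
    where
    go : ∀ x → Acc _<ᴸ_ x → (∀ j → JoinIrr L j → j ≤ x → j ≤ y) → x ≤ y
    go x (acc rec) below with IsBot? x | JoinIrr? x
    ... | yes (_ , x≤) | _       = x≤ y tt
    ... | no _         | yes jx  = below x jx ≤-refl
    ... | no x≢⊥       | no ¬jx  with ¬JoinIrr⇒proper-join x x≢⊥ ¬jx
    ...   | b , c , refl , b≢ , c≢ = ∨-least (part (x≤x∨y b c) b≢) (part (y≤x∨y b c) c≢)
      where
      part : ∀ {a} → a ≤ (b ∨ c) → a ≢ (b ∨ c) → a ≤ y
      part a≤ a≢ = go _ (rec (≤∧≢⇒<ᴸ a≤ a≢)) λ j jj j≤a → below j jj (≤-trans j≤a a≤)

  least-element : Fin n → Σ (Fin n) λ ⊥ → ∀ b → ⊥ ≤ b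
  least-element e = foldr _∧_ e (allFin n) , λ b → ⋀≤ (∈-allFin b)
    where
    ⋀≤ : ∀ {xs b} → b ∈ xs → foldr _∧_ e xs ≤ b
    ⋀≤ (here refl) = x∧y≤x _ _
    ⋀≤ (there b∈)  = ≤-trans (x∧y≤y _ _) (⋀≤ b∈)

  module WithBottom (⊥L : Fin n) (⊥-least : ∀ b → ⊥L ≤ b) where

    Atom : Fin n → Set
    Atom = Covers Whole _≤_ ⊥L

    Atom? : ∀ a → Dec (Atom a)
    Atom? a = map′ (λ (⊥<a , cov) → tt , tt , ⊥<a , λ c _ → cov c)
                   (λ (_ , _ , ⊥<a , cov) → ⊥<a , λ c → cov c tt)
                   (<ᴸ? ⊥L a ×-dec Finₚ.all? (λ c → <ᴸ? ⊥L c →-dec ¬? (<ᴸ? c a)))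

    ≤⊥⇒IsBot : ∀ {a} → a ≤ ⊥L → IsBot Whole _≤_ a
    ≤⊥⇒IsBot a≤⊥ = tt , λ b _ → ≤-trans a≤⊥ (⊥-least b)

    IsAtom⇒Atom : ∀ {a} → IsAtom Whole _≤_ a → Atom a
    IsAtom⇒Atom (z , (_ , z≤) , cov) =
      subst (λ z → Covers Whole _≤_ z _) (antisym (z≤ ⊥L tt) (⊥-least z)) cov

    Atom⇒IsAtom : ∀ {a} → Atom a → IsAtom Whole _≤_ a
    Atom⇒IsAtom cov = ⊥L , (tt , λ b _ → ⊥-least b) , cov

    Atom⇒≰⊥ : ∀ {a} → Atom a → ¬ a ≤ ⊥L
    Atom⇒≰⊥ (_ , _ , (_ , a≰⊥) , _) = a≰⊥

    <ᴸAtom⇒≤⊥ : ∀ {a b} → Atom a → b <ᴸ a → b ≤ ⊥L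
    <ᴸAtom⇒≤⊥ {b = b} (_ , _ , _ , cov) b<a with b ≤? ⊥L
    ... | yes b≤⊥ = b≤⊥
    ... | no b≰⊥  = ⊥-elim (cov b tt (⊥-least b , b≰⊥) b<a)

    Atom⇒JoinIrr : ∀ {a} → Atom a → JoinIrr L a
    Atom⇒JoinIrr {a} atom = (λ (_ , a≤) → Atom⇒≰⊥ atom (a≤ ⊥L tt)) , irreducible
      where
      irreducible : ∀ b c → b ∨ c ≡ a → b ≡ a ⊎ c ≡ a
      irreducible b c refl with b Finₚ.≟ a | c Finₚ.≟ a
      ... | yes b≡a | _       = inj₁ b≡a
      ... | no _    | yes c≡a = inj₂ c≡a
      ... | no b≢a  | no c≢a  = ⊥-elim (Atom⇒≰⊥ atom (∨-least
              (<ᴸAtom⇒≤⊥ atom (≤∧≢⇒<ᴸ (x≤x∨y b c) b≢a))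
              (<ᴸAtom⇒≤⊥ atom (≤∧≢⇒<ᴸ (y≤x∨y b c) c≢a))))

    InH⇒≰Atom : ∀ {q a} → InH L q → Atom a → ¬ q ≤ a
    InH⇒≰Atom {q} {a} (q≢⊥ , q-not-atom) atom q≤a with q Finₚ.≟ a
    ... | yes refl = q-not-atom (Atom⇒IsAtom atom)
    ... | no q≢a   = q≢⊥ (≤⊥⇒IsBot (<ᴸAtom⇒≤⊥ atom (≤∧≢⇒<ᴸ q≤a q≢a)))

    atom-below : ∀ x → ¬ x ≤ ⊥L → ∃ λ a → Atom a × a ≤ x
    atom-below x = go x (<ᴸ-wellFounded x)
      where
      go : ∀ x → Acc _<ᴸ_ x → ¬ x ≤ ⊥L → ∃ λ a → Atom a × a ≤ x
      go x (acc rec) x≰⊥ with Atom? x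
      ... | yes atom = x , atom , ≤-refl
      ... | no ¬atom with Finₚ.any? (λ c → <ᴸ? ⊥L c ×-dec <ᴸ? c x)
      ...   | yes (c , (_ , c≰⊥) , c<x) =
                let a , atom , a≤c = go c (rec c<x) c≰⊥ in a , atom , ≤-trans a≤c (proj₁ c<x)
      ...   | no nothing-between =
                ⊥-elim (¬atom (tt , tt , (⊥-least x , x≰⊥) ,
                  λ c _ ⊥<c c<x → nothing-between (c , ⊥<c , c<x)))

Inserted : (L : FinLattice) → (Fin (FinLattice.n L) → ℕ) → Set
Inserted L d = Σ (Fin (FinLattice.n L)) λ x → Fin (d x)

Fin⇒0< : ∀ {k} → Fin k → 0 < k
Fin⇒0< zero    = s≤s z≤n
Fin⇒0< (suc _) = s≤s z≤n

Fin-unique : ∀ {k} → ¬ 2 ℕ.≤ k → (i j : Fin k) → i ≡ j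
Fin-unique {suc zero}    _      zero zero = refl
Fin-unique {suc (suc _)} k≱2 _    _    = ⊥-elim (k≱2 (s≤s (s≤s z≤n)))

Removable : (L : FinLattice) → (Fin (FinLattice.n L) → ℕ) → Fin (FinLattice.n L) → Set
Removable L d x = 0 < d x × (JoinIrr L x → 2 ℕ.≤ d x)

Removable? : ∀ L d x → Dec (Removable L d x)
Removable? L d x = (0 ℕ.<? d x) ×-dec (FiniteLattice.JoinIrr? L x →-dec (2 ℕ.≤? d x))

anchor : (L : FinLattice) (d : Fin (FinLattice.n L) → ℕ) → Elt L d → Fin (FinLattice.n L)
anchor L d (inj₁ a)       = a
anchor L d (inj₂ (x , _)) = x

module StandardForm (L : FinLattice) (⊥L : Fin (FinLattice.n L))
                    (⊥-least : ∀ b → FinLattice._≤_ L ⊥L b)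
                    (d : Fin (FinLattice.n L) → ℕ) (valid : ValidΔ L d) where
  open FinLattice L
  open IsLattice isLattice renaming (refl to ≤-refl; trans to ≤-trans)
  open FiniteLattice L
  open WithBottom ⊥L ⊥-least

  anchor-InH : (p : Inserted L d) → InH L (proj₁ p)
  anchor-InH (x , i) = valid x (Fin⇒0< i)

  Ord-≤-trans : ∀ a {x y} → Ord L d a (inj₁ x) → x ≤ y → Ord L d a (inj₁ y)
  Ord-≤-trans (inj₁ _) a≤x x≤y = ≤-trans a≤x x≤y
  Ord-≤-trans (inj₂ _) a≤x x≤y = ≤-trans a≤x x≤y

  module InducedAtoms (D : Elt L d → Set) (D-L : ∀ a → D (inj₁ a)) where

    IsBot-⊥ : IsBot D (Ord L d) (inj₁ ⊥L)
    IsBot-⊥ = D-L ⊥L , λ { (inj₁ b) _ → ⊥-least b ; (inj₂ _) _ → tt , λ b _ → ⊥-least b }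

    IsAtom-inj₁⁺ : ∀ {a} → Atom a → IsAtom D (Ord L d) (inj₁ a)
    IsAtom-inj₁⁺ {a} atom@(_ , _ , ⊥<a , cov) = inj₁ ⊥L , IsBot-⊥ , D-L ⊥L , D-L a , ⊥<a , nothing-between
      where
      nothing-between : ∀ c → D c → Lt D (Ord L d) (inj₁ ⊥L) c → ¬ Lt D (Ord L d) c (inj₁ a)
      nothing-between (inj₁ c) _ ⊥<c c<a      = cov c tt ⊥<c c<a
      nothing-between (inj₂ p) _ _   (p≤a , _) = InH⇒≰Atom (anchor-InH p) atom p≤a

    IsAtom-inj₂⁺ : ∀ {p} → D (inj₂ p) → IsAtom D (Ord L d) (inj₂ p)
    IsAtom-inj₂⁺ {p} Dp = inj₁ ⊥L , IsBot-⊥ , D-L ⊥L , Dp , ⊥<p , nothing-between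
      where
      ⊥<p : Lt D (Ord L d) (inj₁ ⊥L) (inj₂ p)
      ⊥<p = (tt , λ b _ → ⊥-least b) , λ p≤⊥ → proj₁ (anchor-InH p) (≤⊥⇒IsBot p≤⊥)
      nothing-between : ∀ c → D c → Lt D (Ord L d) (inj₁ ⊥L) c → ¬ Lt D (Ord L d) c (inj₂ p)
      nothing-between (inj₁ c) _ (_ , c≰⊥) ((_ , c≤) , _) = c≰⊥ (c≤ ⊥L tt)
      nothing-between (inj₂ q) _ _         (refl , q≠p)   = q≠p refl

    IsAtom-inj₁⁻ : ∀ {a} → IsAtom D (Ord L d) (inj₁ a) → Atom a
    IsAtom-inj₁⁻ {a} (inj₁ z , (_ , z≤) , _ , _ , z<a , cov) =
      subst (λ z → Covers Whole _≤_ z a) (antisym (z≤ (inj₁ ⊥L) (D-L ⊥L)) (⊥-least z))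
        (tt , tt , z<a , λ c _ → cov (inj₁ c) (D-L c))
    IsAtom-inj₁⁻ (inj₂ p , (_ , p≤) , _) =
      ⊥-elim (proj₁ (anchor-InH p) (≤⊥⇒IsBot (p≤ (inj₁ ⊥L) (D-L ⊥L))))

  module Q = InducedAtoms Whole (λ _ → tt)

  atoms≤joinIrr : ∀ {k m} → ¬ ∃ (Removable L d) →
    HasSize (IsAtom Whole (Ord L d)) k → HasSize (JoinIrr L) m → k ℕ.≤ m
  atoms≤joinIrr none atoms joinIrrs =
    HasSize-injection⇒≤ atoms joinIrrs (anchor L d) anchor-JoinIrr anchor-injective
    where
    inhabited-fibre : ∀ {x} → Fin (d x) → JoinIrr L x × ¬ 2 ℕ.≤ d x
    inhabited-fibre {x} i with JoinIrr? x
    ... | yes ji = ji , λ two → none (x , Fin⇒0< i , λ _ → two)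
    ... | no ¬ji = ⊥-elim (none (x , Fin⇒0< i , ⊥-elim ∘ ¬ji))

    anchor-JoinIrr : ∀ {e} → IsAtom Whole (Ord L d) e → JoinIrr L (anchor L d e)
    anchor-JoinIrr {inj₁ _}       atom = Atom⇒JoinIrr (Q.IsAtom-inj₁⁻ atom)
    anchor-JoinIrr {inj₂ (_ , i)} _    = proj₁ (inhabited-fibre i)

    anchor-injective : ∀ {e e′} → IsAtom Whole (Ord L d) e → IsAtom Whole (Ord L d) e′ →
                       anchor L d e ≡ anchor L d e′ → e ≡ e′
    anchor-injective {inj₁ _}       {inj₁ _}       _    _    refl = refl
    anchor-injective {inj₁ a}       {inj₂ (_ , i)} atom _    refl =
      ⊥-elim (proj₂ (anchor-InH (a , i)) (Atom⇒IsAtom (Q.IsAtom-inj₁⁻ atom)))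
    anchor-injective {inj₂ (x , i)} {inj₁ _}       _    atom refl =
      ⊥-elim (proj₂ (anchor-InH (x , i)) (Atom⇒IsAtom (Q.IsAtom-inj₁⁻ atom)))
    anchor-injective {inj₂ (x , i)} {inj₂ (_ , j)} _    _    refl =
      cong (λ i → inj₂ (x , i)) (Fin-unique (proj₂ (inhabited-fibre i)) i j)

  removable-point : ∀ {k m} → HasSize (IsAtom Whole (Ord L d)) k → HasSize (JoinIrr L) m →
                    m < k → ∃ (Removable L d)
  removable-point atoms joinIrrs m<k with Finₚ.any? (Removable? L d)
  ... | yes removable = removable
  ... | no none = ⊥-elim (ℕₚ.<⇒≱ m<k (atoms≤joinIrr none atoms joinIrrs))

RetainsΔ : (L : FinLattice) (d : Fin (FinLattice.n L) → ℕ) → Elt L d → Set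
RetainsΔ L d r = ∀ j → JoinIrr L j → InH L j → Σ (Fin (d j)) λ i → inj₂ (j , i) ≢ r

punchInPred : ∀ {k} → Fin k → Fin (pred k) → Fin k
punchInPred {suc _} = Fin.punchIn

punchInPred-injective : ∀ {k} (i : Fin k) {j j′} → punchInPred i j ≡ punchInPred i j′ → j ≡ j′
punchInPred-injective {suc _} i = Finₚ.punchIn-injective i _ _

punchInPredᵢ≢i : ∀ {k} (i : Fin k) j → punchInPred i j ≢ i
punchInPredᵢ≢i {suc _} = Finₚ.punchInᵢ≢i

punchInPred-onto : ∀ {k} {i j : Fin k} → i ≢ j → ∃ λ j′ → punchInPred i j′ ≡ j
punchInPred-onto {suc _} i≢j = Fin.punchOut i≢j , Finₚ.punchIn-punchOut i≢j

module FibrewiseRemoval (L : FinLattice) (d d′ : Fin (FinLattice.n L) → ℕ) (r₀ : Inserted L d)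
  (e : ∀ x → Fin (d′ x) → Fin (d x))
  (e-injective : ∀ x {i j} → e x i ≡ e x j → i ≡ j)
  (e-avoids : ∀ x i → (x , e x i) ≢ r₀)
  (e-onto : ∀ x j → (x , j) ≢ r₀ → ∃ λ i → e x i ≡ j) where

  ψ : Elt L d′ → Elt L d
  ψ (inj₁ a)       = inj₁ a
  ψ (inj₂ (x , i)) = inj₂ (x , e x i)

  ψ-avoids : ∀ p → ψ p ≢ inj₂ r₀
  ψ-avoids (inj₁ _)       ()
  ψ-avoids (inj₂ (x , i)) eq = e-avoids x i (inj₂-injective eq)

  ψ-onto : ∀ q → q ≢ inj₂ r₀ → ∃ λ p → ψ p ≡ q
  ψ-onto (inj₁ a)       _   = inj₁ a , refl
  ψ-onto (inj₂ (x , j)) q≢r with e-onto x j (q≢r ∘ cong inj₂)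
  ... | i , refl = inj₂ (x , i) , refl

  ψ-injective : ∀ p p′ → ψ p ≡ ψ p′ → p ≡ p′
  ψ-injective (inj₁ _)       (inj₁ _)       refl = refl
  ψ-injective (inj₂ (x , i)) (inj₂ (y , j)) eq
    with ,-injectiveˡ (inj₂-injective eq)
  ... | refl = cong (λ i → inj₂ (x , i)) (e-injective x (,-injectiveʳ (inj₂-injective eq)))

  ψ-order-embedding : ∀ p p′ → (Ord L d′ p p′ → Ord L d (ψ p) (ψ p′)) ×
                               (Ord L d (ψ p) (ψ p′) → Ord L d′ p p′)
  ψ-order-embedding (inj₁ _) (inj₁ _) = id , id
  ψ-order-embedding (inj₁ _) (inj₂ _) = id , id
  ψ-order-embedding (inj₂ _) (inj₁ _) = id , id
  ψ-order-embedding (inj₂ p) (inj₂ q) =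
    (λ { refl → refl }) , λ eq → inj₂-injective (ψ-injective (inj₂ p) (inj₂ q) (cong inj₂ eq))

  removalIsESF : IsESF L d′ → RemovalIsESF L d (inj₂ r₀)
  removalIsESF esf′ = d′ , esf′ , ψ , ψ-avoids , ψ-onto , ψ-injective , ψ-order-embedding , λ _ → refl

  retainsΔ : IsESF L d′ → RetainsΔ L d (inj₂ r₀)
  retainsΔ (_ , nonempty) j ji j∈H =
    e j (Fin.fromℕ< (nonempty j ji j∈H)) , e-avoids j _ ∘ inj₂-injective

module RemoveOne (L : FinLattice) (d : Fin (FinLattice.n L) → ℕ)
                 (x₀ : Fin (FinLattice.n L)) (i₀ : Fin (d x₀)) where
  open FinLattice L using (n)

  fibre : ∀ x → Dec (x ≡ x₀) → ℕ
  fibre x (yes _) = pred (d x)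
  fibre x (no _)  = d x

  d′ : Fin n → ℕ
  d′ x = fibre x (x Finₚ.≟ x₀)

  embed : ∀ x x≟x₀ → Fin (fibre x x≟x₀) → Fin (d x)
  embed x (yes refl) = punchInPred i₀
  embed x (no _)     = id

  embed-injective : ∀ x x≟x₀ {i j} → embed x x≟x₀ i ≡ embed x x≟x₀ j → i ≡ j
  embed-injective x (yes refl) = punchInPred-injective i₀
  embed-injective x (no _)     = id

  embed-avoids : ∀ x x≟x₀ i → (x , embed x x≟x₀ i) ≢ (x₀ , i₀)
  embed-avoids x (yes refl) i = punchInPredᵢ≢i i₀ i ∘ ,-injectiveʳ
  embed-avoids x (no x≢x₀)  i = x≢x₀ ∘ ,-injectiveˡ

  embed-onto : ∀ x x≟x₀ j → (x , j) ≢ (x₀ , i₀) → ∃ λ i → embed x x≟x₀ i ≡ j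
  embed-onto x (yes refl) j ne = punchInPred-onto (ne ∘ cong (x₀ ,_) ∘ sym)
  embed-onto x (no _)     j _  = j , refl

  d′-IsESF : IsESF L d → (JoinIrr L x₀ → 2 ℕ.≤ d x₀) → IsESF L d′
  d′-IsESF (valid , nonempty) x₀-two =
    (λ x 0<d′x → valid x (ℕₚ.<-≤-trans 0<d′x (fibre≤d x (x Finₚ.≟ x₀)))) ,
    λ x ji x∈H → fibre-nonempty x (x Finₚ.≟ x₀) ji x∈H
    where
    fibre≤d : ∀ x x≟x₀ → fibre x x≟x₀ ℕ.≤ d x
    fibre≤d x (yes _) = ℕₚ.pred[n]≤n
    fibre≤d x (no _)  = ℕₚ.≤-refl
    fibre-nonempty : ∀ x x≟x₀ → JoinIrr L x → InH L x → 0 < fibre x x≟x₀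
    fibre-nonempty x (yes refl) ji _   = ℕₚ.pred-mono-≤ (x₀-two ji)
    fibre-nonempty x (no _)     ji x∈H = nonempty x ji x∈H

  open FibrewiseRemoval L d d′ (x₀ , i₀) (λ x → embed x (x Finₚ.≟ x₀))
    (λ x → embed-injective x (x Finₚ.≟ x₀)) (λ x → embed-avoids x (x Finₚ.≟ x₀))
    (λ x → embed-onto x (x Finₚ.≟ x₀)) public
    using (removalIsESF; retainsΔ)

module Traces (L : FinLattice) (⊥L : Fin (FinLattice.n L))
              (⊥-least : ∀ b → FinLattice._≤_ L ⊥L b)
              (d : Fin (FinLattice.n L) → ℕ) (valid : ValidΔ L d)
              (r₀ : Inserted L d) (retains : RetainsΔ L d (inj₂ r₀)) where
  open FinLattice L
  open IsLattice isLattice renaming (refl to ≤-refl; trans to ≤-trans)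
  open FiniteLattice L
  open WithBottom ⊥L ⊥-least
  open StandardForm L ⊥L ⊥-least d valid

  r : Elt L d
  r = inj₂ r₀

  T : Fin n → Elt L d → Set
  T = Tset L d r

  A : Elt L d → Elt L d → Set
  A = AP L d r

  module P = InducedAtoms (DP L d r) (λ _ ())

  T≐A : ∀ x → T x ≐ A (inj₁ x)
  T≐A x = T⊆A , A⊆T
    where
    T⊆A : T x ⊆ A (inj₁ x)
    T⊆A (inj₁ a) (atom , a≤x , _)   = P.IsAtom-inj₁⁺ (Q.IsAtom-inj₁⁻ atom) , a≤x
    T⊆A (inj₂ p) (_    , p≤x , p≢r) = P.IsAtom-inj₂⁺ p≢r , p≤x
    A⊆T : A (inj₁ x) ⊆ T x
    A⊆T (inj₁ a) (atom , a≤x)                     = Q.IsAtom-inj₁⁺ (P.IsAtom-inj₁⁻ atom) , a≤x , λ ()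
    A⊆T (inj₂ p) ((_ , _ , _ , p≢r , _) , p≤x) = Q.IsAtom-inj₂⁺ tt , p≤x , p≢r

  T-mono : ∀ {x y} → x ≤ y → T x ⊆ T y
  T-mono x≤y a (atom , a≤x , a≢r) = atom , Ord-≤-trans a a≤x x≤y , a≢r

  T-∧ : ∀ {x y} a → T x a → T y a → T (x ∧ y) a
  T-∧ (inj₁ _) (atom , a≤x , a≢r) (_ , a≤y , _) = atom , ∧-greatest a≤x a≤y , a≢r
  T-∧ (inj₂ _) (atom , p≤x , p≢r) (_ , p≤y , _) = atom , ∧-greatest p≤x p≤y , p≢r

  T-empty : ∀ {x} → x ≤ ⊥L → ∀ a → ¬ T x a
  T-empty x≤⊥ (inj₁ _) (atom , a≤x , _) = Atom⇒≰⊥ (Q.IsAtom-inj₁⁻ atom) (≤-trans a≤x x≤⊥)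
  T-empty x≤⊥ (inj₂ p) (_    , p≤x , _) = proj₁ (anchor-InH p) (≤⊥⇒IsBot (≤-trans p≤x x≤⊥))

  T⊆A-inj₂⇒≤⊥ : ∀ {x p} → T x ⊆ A (inj₂ p) → x ≤ ⊥L
  T⊆A-inj₂⇒≤⊥ {x} T⊆A with x ≤? ⊥L
  ... | yes x≤⊥ = x≤⊥
  ... | no x≰⊥ with atom-below x x≰⊥
  ...   | a , atom , a≤x with T⊆A (inj₁ a) (Q.IsAtom-inj₁⁺ atom , a≤x , λ ())
  ...     | _ , (_ , a≤⊥) = ⊥-elim (Atom⇒≰⊥ atom (a≤⊥ ⊥L tt))

  T-reflects : ∀ {x y} → T x ⊆ T y → x ≤ y
  T-reflects {x} {y} Tx⊆Ty = ≤-by-joinIrr x y below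
    where
    below : ∀ j → JoinIrr L j → j ≤ x → j ≤ y
    below j ji j≤x with Atom? j
    ... | yes atom = proj₁ (proj₂ (Tx⊆Ty (inj₁ j) (Q.IsAtom-inj₁⁺ atom , j≤x , λ ())))
    ... | no ¬atom =
      let i , j,i≢r = retains j ji (proj₁ ji , ¬atom ∘ IsAtom⇒Atom)
      in proj₁ (proj₂ (Tx⊆Ty (inj₂ (j , i)) (Q.IsAtom-inj₂⁺ tt , j≤x , j,i≢r)))

  T≅L : TIsoL L d r
  T≅L = id , (λ z → z , (λ _ → id) , (λ _ → id)) , λ _ _ → T-mono , T-reflects

  T-sublattice : TSublattice L d r
  T-sublattice =
    (λ x → inj₁ x , (λ ()) , T≐A x) ,
    (λ x y → x ∨ y , T-mono (x≤x∨y x y) , T-mono (y≤x∨y x y) , join-least x y) ,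
    (λ x y → x ∧ y , T-mono (x∧y≤x x y) , T-mono (x∧y≤y x y) ,
       λ _ _ Aw⊆Tx Aw⊆Ty a a∈Aw → T-∧ a (Aw⊆Tx a a∈Aw) (Aw⊆Ty a a∈Aw))
    where
    join-least : ∀ x y w → DP L d r w → T x ⊆ A w → T y ⊆ A w → T (x ∨ y) ⊆ A w
    join-least x y (inj₁ w) _ Tx⊆Aw Ty⊆Aw =
      λ a a∈T → proj₁ (T≐A w) a (T-mono (∨-least x≤w y≤w) a a∈T)
      where
      x≤w : x ≤ w
      x≤w = T-reflects λ a → proj₂ (T≐A w) a ∘ Tx⊆Aw a
      y≤w : y ≤ w
      y≤w = T-reflects λ a → proj₂ (T≐A w) a ∘ Ty⊆Aw a
    join-least x y (inj₂ _) _ Tx⊆Ap Ty⊆Ap a a∈T =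
      ⊥-elim (T-empty (∨-least (T⊆A-inj₂⇒≤⊥ Tx⊆Ap) (T⊆A-inj₂⇒≤⊥ Ty⊆Ap)) a a∈T)

  -- Only T ⊥ = ∅ can lie below a singleton A (inj₂ p); then T a, for an atom a below
  -- the anchor of p, lies strictly between T ⊥ and any T y containing p.
  T-cover-preserving : TCoverPreserving L d r
  T-cover-preserving x y _ no-T-between (inj₁ w) _ (Tx⊂Aw , Aw⊂Ty) =
    no-T-between w (⊂-respʳ-≐ (≐-sym (T≐A w)) Tx⊂Aw , ⊂-respˡ-≐ (≐-sym (T≐A w)) Aw⊂Ty)
  T-cover-preserving x y _ no-T-between (inj₂ p) p≢r ((Tx⊆Ap , _) , (Ap⊆Ty , _))
    with atom-below (proj₁ p) (proj₁ (anchor-InH p) ∘ ≤⊥⇒IsBot)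
  ... | a , atom , a≤p = no-T-between a (Tx⊂Ta , Ta⊂Ty)
    where
    x≤⊥ : x ≤ ⊥L
    x≤⊥ = T⊆A-inj₂⇒≤⊥ Tx⊆Ap
    p∈Ty : T y (inj₂ p)
    p∈Ty = Ap⊆Ty (inj₂ p) (P.IsAtom-inj₂⁺ p≢r , refl)
    Tx⊂Ta : T x ⊂ T a
    Tx⊂Ta = (λ b b∈Tx → ⊥-elim (T-empty x≤⊥ b b∈Tx)) ,
            λ Ta⊆Tx → T-empty x≤⊥ (inj₁ a) (Ta⊆Tx (inj₁ a) (Q.IsAtom-inj₁⁺ atom , ≤-refl , λ ()))
    Ta⊂Ty : T a ⊂ T y
    Ta⊂Ty = T-mono (≤-trans a≤p (proj₁ (proj₂ p∈Ty))) ,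
            λ Ty⊆Ta → InH⇒≰Atom (anchor-InH p) atom (proj₁ (proj₂ (Ty⊆Ta (inj₂ p) p∈Ty)))

lemma3p2 : (L : FinLattice) → Semimodular L →
    (d : Fin (FinLattice.n L) → ℕ) → IsESF L d →
    (Σ ℕ λ k → Σ ℕ λ m →
      HasSize (IsAtom Whole (Ord L d)) k × HasSize (JoinIrr L) m × m < k) →
    Σ (Fin (FinLattice.n L)) λ x → Σ (Fin (d x)) λ i →
      RemovalIsESF L d (inj₂ (x , i)) ×
      TIsoL L d (inj₂ (x , i)) ×
      TSublattice L d (inj₂ (x , i)) ×
      TCoverPreserving L d (inj₂ (x , i))
lemma3p2 L _ d esf@(valid , _) (k , m , atoms , joinIrrs , m<k) =
  let q , _ = HasSize-inhabited atoms (ℕₚ.≤-<-trans z≤n m<k)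
      ⊥L , ⊥-least = FiniteLattice.least-element L (anchor L d q)
      open StandardForm L ⊥L ⊥-least d valid
      x₀ , 0<d , x₀-two = removable-point atoms joinIrrs m<k
      i₀ = Fin.fromℕ< 0<d
      open RemoveOne L d x₀ i₀
      esf′ = d′-IsESF esf x₀-two
      open Traces L ⊥L ⊥-least d valid (x₀ , i₀) (retainsΔ esf′)
  in x₀ , i₀ , removalIsESF esf′ , T≅L , T-sublattice , T-cover-preserving
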